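{- For every integer $n\geq 4$, there exists a tree $T$ on $n+3$ vertices that is neutral, i.e. whose assortativity coefficient satisfies $r=0$.
   Context: All graphs are simple and connected. For a graph $G=(V,E)$ with $m=|E|\geq 1$ edges, where $d_u$ is the degree of vertex $u$ and $e_{uv}$ denotes the edge with endpoints $u,v$, the assortativity coefficient is $$r=\frac{m^{ -1}\sum_{e_{uv}\in E} d_{u}d_{v}-\Big[m^{ -1}\sum_{e_{uv}\in E} \tfrac{1}{2}(d_{u}+d_{v})\Big]^{2}}{m^{ -1}\sum_{e_{uv}\in E} \tfrac{1}{2}(d^{2}_{u}+d^{2}_{v})-\Big[m^{ -1}\sum_{e_{uv}\in E} \tfrac{1}{2}(d_{u}+d_{v})\Big]^{2}}.$$ $G$ is called neutral if $r$ is well defined (nonzero denominator) and $r=0$. -}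

module Defs where

open import Data.Nat as ℕ using (ℕ; zero; suc; _≤_)
open import Data.Fin using (Fin; _<_; _≟_)
open import Data.Integer using (+_)
open import Data.Rational using (ℚ; 0ℚ; ½; _+_; _*_; _-_; _/_)
open import Data.Product using (Σ; _×_; _,_; ∃)
open import Data.Sum using (_⊎_)
open import Data.List using (List; []; _∷_; length; map; foldr; _∷ʳ_)
open import Data.List.Membership.Propositional using (_∈_)
open import Data.List.Relation.Unary.All using (All)
open import Data.List.Relation.Unary.Unique.Propositional using (Unique)
open import Data.List.Relation.Unary.Linked using (Linked)
open import Relation.Nullary using (¬_; yes; no)
open import Relation.Binary.PropositionalEquality using (_≡_; _≢_)

-- Each edge e_uv is stored once, as an ordered pair (u , v) with u < v
-- (this excludes loops), and the list has no repeated entries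
-- (this excludes multiple edges).
record Graph (n : ℕ) : Set where
  field
    edges    : List (Fin n × Fin n)
    oriented : All (λ e → Σ.proj₁ e < Σ.proj₂ e) edges
    nodup    : Unique edges
open Graph public

module _ {n : ℕ} (G : Graph n) where

  Adj : Fin n → Fin n → Set
  Adj u v = ((u , v) ∈ edges G) ⊎ ((v , u) ∈ edges G)

  data Reach : Fin n → Fin n → Set where
    here : ∀ {u} → Reach u u
    step : ∀ {u w v} → Adj u w → Reach w v → Reach u v

  Connected : Set
  Connected = ∀ u v → Reach u v

  IsCycle : Fin n → List (Fin n) → Set
  IsCycle v₀ vs = (2 ≤ length vs) × Unique (v₀ ∷ vs) × Linked Adj ((v₀ ∷ vs) ∷ʳ v₀)

  Acyclic : Set
  Acyclic = ∀ v₀ vs → ¬ IsCycle v₀ vs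

  IsTree : Set
  IsTree = Connected × Acyclic

  deg : Fin n → ℕ
  deg u = foldr (λ e acc → ind (Σ.proj₁ e) ℕ.+ ind (Σ.proj₂ e) ℕ.+ acc) 0 (edges G)
    where
      ind : Fin n → ℕ
      ind w with w ≟ u
      ... | yes _ = 1
      ... | no _  = 0

  dq : Fin n → ℚ
  dq u = + deg u / 1

  -- m^{-1} Σ_{e_uv ∈ E} f(u,v)  (m = number of edges; the value for m = 0
  -- is irrelevant, set to 0)
  edgeMean : (Fin n → Fin n → ℚ) → ℚ
  edgeMean f with edges G
  ... | [] = 0ℚ
  ... | es@(_ ∷ es') = foldr (λ e acc → f (Σ.proj₁ e) (Σ.proj₂ e) + acc) 0ℚ es
                       * (+ 1 / suc (length es'))

  meanDeg : ℚ
  meanDeg = edgeMean (λ u v → ½ * (dq u + dq v))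

  assortNum : ℚ
  assortNum = edgeMean (λ u v → dq u * dq v) - meanDeg * meanDeg

  assortDen : ℚ
  assortDen = edgeMean (λ u v → ½ * (dq u * dq u + dq v * dq v)) - meanDeg * meanDeg

  -- neutral: r = assortNum / assortDen is well defined (denominator ≠ 0)
  -- and r = 0 (equivalently, since the denominator is nonzero, numerator = 0)
  Neutral : Set
  Neutral = (assortDen ≢ 0ℚ) × (assortNum ≡ 0ℚ)

{-# OPTIONS --safe #-}
module Submission where

-- The tree is the spider with legs of lengths n − 2, 2 and 2.  Only six of its m = n + 2 edges
-- touch a leaf or the centre; every other edge joins two vertices of degree 2.  Hence, for any
-- ψ, the edge mean of ψ(d_u, d_v) is ψ(2, 2) + e(ψ)/m, where e(ψ) is the total deviation of
-- those six edges from ψ(2, 2).  The deviation is 0 for d_u d_v and for (d_u + d_v)/2, so the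
-- mean degree is 2 and the numerator of r is 4 − 2·2 = 0; for (d_u² + d_v²)/2 it is 3, so the
-- denominator is 3/m ≠ 0.
--
-- The vertices are numbered so that each vertex v > 0 has exactly one smaller neighbour.
-- Following smaller neighbours leads to 0, so the graph is connected.  A walk without repeated
-- vertices that goes up once keeps going up (two smaller neighbours of its next vertex would
-- coincide), so a cycle that starts upwards climbs back to its own start; one that starts
-- downwards is rotated to start at a smaller vertex.

open import Defs
open import Data.Nat using (ℕ; zero; suc; _≤_; _+_; s≤s; z≤n; z<s; s<s)
open import Data.Nat.Properties using (+-suc)
open import Data.Nat.Coprimality using (1-coprimeTo)
import Data.Nat.Coprimality as Coprime
open import Data.Integer using (+_)
import Data.Integer as ℤ
import Data.Integer.Properties as ℤ
open import Data.Rational using (ℚ; mkℚ; 0ℚ; 1ℚ; ½; _/_)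
import Data.Rational as ℚ
import Data.Rational.Properties as ℚ
open import Data.Rational.Properties using (normalize-coprime; normalize-pos)
open import Data.Rational.Solver using (module +-*-Solver)
open +-*-Solver using (solve; _:=_; _:+_; _:*_; _:-_)
open import Data.Fin using (Fin; zero; suc; _<_; _≟_; #_)
open import Data.Fin.Properties using (<-cmp; <-asym; <-trans; <-irrefl; suc-injective)
open import Data.Fin.Induction using (<-wellFounded)
open import Data.Product using (Σ; _×_; _,_; proj₁; proj₂)
import Data.Product as Product
open import Data.Sum using (inj₁; inj₂; swap)
open import Data.Empty using (⊥-elim)
open import Data.List using (List; []; _∷_; _++_; _∷ʳ_; map; foldr; length; replicate; allFin)
open import Data.List.Properties
  using (foldr-cong; foldr-map; length-map; length-++; length-replicate; length-++-≤ʳ;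
         map-∘; map-tabulate; ∷-injectiveˡ; ∷-injectiveʳ)
open import Data.List.Membership.Propositional using (_∈_)
open import Data.List.Membership.Propositional.Properties using (∈-map⁺; ∈-map⁻; ∈-allFin)
open import Data.List.Relation.Unary.Any using (here; there)
open import Data.List.Relation.Unary.All as All using (All; []; _∷_)
import Data.List.Relation.Unary.All.Properties as All
open import Data.List.Relation.Unary.AllPairs as AllPairs using ([]; _∷_)
open import Data.List.Relation.Unary.Linked as Linked using (Linked; []; [-]; _∷_)
open import Data.List.Relation.Unary.Linked.Properties using (Linked⇒AllPairs)
open import Data.List.Relation.Unary.Unique.Propositional using (Unique)
import Data.List.Relation.Unary.Unique.Propositional.Properties as Unique
open import Function using (_∘_; id)
open import Induction.WellFounded using (Acc; acc)
open import Relation.Binary using (Transitive; tri<; tri≈; tri>)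
open import Relation.Binary.PropositionalEquality
open import Relation.Nullary using (¬_; yes; no)

variable
  n : ℕ

unique-rotate : ∀ {A : Set} {x : A} {xs} → Unique (x ∷ xs) → Unique (xs ∷ʳ x)
unique-rotate (x∉xs ∷ uniq) =
  Unique.++⁺ uniq ([] ∷ []) λ { (v∈xs , here refl) → All.lookup x∉xs v∈xs refl }

Linked-∷ʳ⁺ : ∀ {A : Set} {R : A → A → Set} xs {y z} → Linked R (xs ∷ʳ y) → R y z → Linked R (xs ∷ʳ y ∷ʳ z)
Linked-∷ʳ⁺ []            _           Ryz = Ryz ∷ [-]
Linked-∷ʳ⁺ (_ ∷ [])      (Rxy ∷ _)   Ryz = Rxy ∷ Ryz ∷ [-]
Linked-∷ʳ⁺ (_ ∷ x′ ∷ xs) (Rxx′ ∷ Rs) Ryz = Rxx′ ∷ Linked-∷ʳ⁺ (x′ ∷ xs) Rs Ryz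

Linked⇒first-last : ∀ {A : Set} {R : A → A → Set} → Transitive R →
                    ∀ {x} xs {y} → Linked R (x ∷ xs ∷ʳ y) → R x y
Linked⇒first-last trans xs chain = proj₂ (All.∷ʳ⁻ {xs = xs} (AllPairs.head (Linked⇒AllPairs trans chain)))

unique-map⇒injective : ∀ {A B : Set} {f : A → B} {xs x y} →
                       Unique (map f xs) → x ∈ xs → y ∈ xs → f x ≡ f y → x ≡ y
unique-map⇒injective _          (here refl) (here refl) _  = refl
unique-map⇒injective (fx∉ ∷ _)  (here refl) (there y∈)  eq = ⊥-elim (All.lookup fx∉ (∈-map⁺ _ y∈) eq)
unique-map⇒injective (fy∉ ∷ _)  (there x∈)  (here refl) eq = ⊥-elim (All.lookup fy∉ (∈-map⁺ _ x∈) (sym eq))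
unique-map⇒injective (_ ∷ uniq) (there x∈)  (there y∈)  eq = unique-map⇒injective uniq x∈ y∈ eq

upperEnds : Graph n → List (Fin n)
upperEnds G = map proj₂ (edges G)

module _ (G : Graph n) where

  Adj-irrefl : ∀ {u v} → Adj G u v → u ≢ v
  Adj-irrefl (inj₁ e) refl = <-irrefl refl (All.lookup (oriented G) e)
  Adj-irrefl (inj₂ e) refl = <-irrefl refl (All.lookup (oriented G) e)

  Reach-trans : ∀ {u v w} → Reach G u v → Reach G v w → Reach G u w
  Reach-trans here        r = r
  Reach-trans (step a r₁) r = step a (Reach-trans r₁ r)

  Reach-sym : ∀ {u v} → Reach G u v → Reach G v u
  Reach-sym here       = here
  Reach-sym (step a r) = Reach-trans (Reach-sym r) (step (swap a) here)

  IsCycle-rotate : ∀ {v₀ v₁ ws} → IsCycle G v₀ (v₁ ∷ ws) → IsCycle G v₁ (ws ∷ʳ v₀)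
  IsCycle-rotate {ws = []} (s≤s () , _)
  IsCycle-rotate {v₀} {ws = _ ∷ ws} (_ , uniq , a₀₁ ∷ path) =
    s≤s (length-++-≤ʳ (v₀ ∷ []) {ws}) , unique-rotate uniq , Linked-∷ʳ⁺ (_ ∷ _ ∷ ws) path a₀₁

  lower-edge : ∀ {w a} → Adj G w a → a < w → (a , w) ∈ edges G
  lower-edge (inj₁ e) a<w = ⊥-elim (<-asym a<w (All.lookup (oriented G) e))
  lower-edge (inj₂ e) _   = e

module _ (G : Graph n) (upper-unique : Unique (upperEnds G)) where

  lower-neighbour-unique : ∀ {w a b} → Adj G w a → Adj G w b → a < w → b < w → a ≡ b
  lower-neighbour-unique Awa Awb a<w b<w =
    cong proj₁ (unique-map⇒injective upper-unique (lower-edge G Awa a<w) (lower-edge G Awb b<w) refl)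

  ascent-continues : ∀ {x y z} → x ≢ z → Adj G x y → Adj G y z → x < y → y < z
  ascent-continues {y = y} {z} x≢z Axy Ayz x<y with <-cmp y z
  ... | tri< y<z _ _ = y<z
  ... | tri≈ _ y≡z _ = ⊥-elim (Adj-irrefl G Ayz y≡z)
  ... | tri> _ _ z<y = ⊥-elim (x≢z (lower-neighbour-unique (swap Axy) Ayz x<y z<y))

  ascent-persists : ∀ {x y} zs → Unique (x ∷ y ∷ zs) → Linked (Adj G) (x ∷ y ∷ zs) → x < y →
                    Linked _<_ (x ∷ y ∷ zs)
  ascent-persists []       _                      _           x<y = x<y ∷ [-]
  ascent-persists (_ ∷ zs) ((_ ∷ x≢z ∷ _) ∷ uniq) (Axy ∷ adj) x<y =
    x<y ∷ ascent-persists zs uniq adj (ascent-continues x≢z Axy (Linked.head adj) x<y)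

  no-cycle-at : ∀ {v₀} → Acc _<_ v₀ → ∀ vs → ¬ IsCycle G v₀ vs
  no-cycle-at _ []       (() , _)
  no-cycle-at _ (_ ∷ []) (s≤s () , _)
  no-cycle-at {v₀} (acc below) (v₁ ∷ v₂ ∷ ws) cyc@(_ , uniq@((_ ∷ v₀≢v₂ ∷ _) ∷ _) , a₀₁ ∷ path)
    with <-cmp v₀ v₁
  ... | tri< v₀<v₁ _ _ = <-asym v₀<v₁ (Linked⇒first-last <-trans (v₂ ∷ ws) climb)
    where
    climb = ascent-persists (ws ∷ʳ v₀) (unique-rotate uniq) path
              (ascent-continues v₀≢v₂ a₀₁ (Linked.head path) v₀<v₁)
  ... | tri≈ _ v₀≡v₁ _ = Adj-irrefl G a₀₁ v₀≡v₁
  ... | tri> _ _ v₁<v₀ = no-cycle-at (below v₁<v₀) (v₂ ∷ ws ∷ʳ v₀) (IsCycle-rotate G cyc)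

  unique-upperEnds⇒acyclic : Acyclic G
  unique-upperEnds⇒acyclic v₀ = no-cycle-at (<-wellFounded v₀)

module _ (G : Graph (suc n)) (covered : ∀ v → suc v ∈ upperEnds G) where

  reaches-zero : ∀ {v} → Acc _<_ v → Reach G v zero
  reaches-zero {zero}  _           = here
  reaches-zero {suc v} (acc below) with ∈-map⁻ proj₂ (covered v)
  ... | _ , e∈ , refl = step (inj₂ e∈) (reaches-zero (below (All.lookup (oriented G) e∈)))

  covering-upperEnds⇒connected : Connected G
  covering-upperEnds⇒connected u v =
    Reach-trans G (reaches-zero (<-wellFounded u)) (Reach-sym G (reaches-zero (<-wellFounded v)))

upperEnds≡⇒IsTree : ∀ (G : Graph (suc n)) → upperEnds G ≡ map suc (allFin n) → IsTree G
upperEnds≡⇒IsTree G eq =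
  covering-upperEnds⇒connected G (λ v → subst (suc v ∈_) (sym eq) (∈-map⁺ suc (∈-allFin v))) ,
  unique-upperEnds⇒acyclic G (subst Unique (sym eq) (Unique.map⁺ suc-injective (Unique.allFin⁺ _)))

δ : Fin n → Fin n → ℕ
δ u w with w ≟ u
... | yes _ = 1
... | no _  = 0

degreeIn : List (Fin n × Fin n) → Fin n → ℕ
degreeIn es u = foldr (λ e s → δ u (proj₁ e) + δ u (proj₂ e) + s) 0 es

-- The step function of `deg` is local to its definition; `degStep` names it.
degStep : (G : Graph n) (u : Fin n) → Σ (Fin n × Fin n → ℕ → ℕ) λ step → deg G u ≡ foldr step 0 (edges G)
degStep G u = _ , refl

degStep≗δ : ∀ (G : Graph n) u a b s → proj₁ (degStep G u) (a , b) s ≡ δ u a + δ u b + s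
degStep≗δ G u a b s with a ≟ u | b ≟ u
... | yes _ | yes _ = refl
... | yes _ | no _  = refl
... | no _  | yes _ = refl
... | no _  | no _  = refl

deg≡degreeIn : ∀ (G : Graph n) u → deg G u ≡ degreeIn (edges G) u
deg≡degreeIn G u = trans (proj₂ (degStep G u)) (foldr-cong (λ (a , b) → degStep≗δ G u a b) refl (edges G))

lift : Fin n × Fin n → Fin (suc n) × Fin (suc n)
lift = Product.map suc suc

δ-suc : ∀ (u w : Fin n) → δ (suc u) (suc w) ≡ δ u w
δ-suc u w with w ≟ u
... | yes _ = refl
... | no _  = refl

degreeIn-lift-zero : ∀ (es : List (Fin n × Fin n)) → degreeIn (map lift es) zero ≡ 0
degreeIn-lift-zero []       = refl
degreeIn-lift-zero (_ ∷ es) = degreeIn-lift-zero es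

degreeIn-lift-suc : ∀ (es : List (Fin n × Fin n)) u → degreeIn (map lift es) (suc u) ≡ degreeIn es u
degreeIn-lift-suc []             u = refl
degreeIn-lift-suc ((a , b) ∷ es) u = cong₂ _+_ (cong₂ _+_ (δ-suc u a) (δ-suc u b)) (degreeIn-lift-suc es u)

addLeaf : Graph (suc n) → Graph (suc (suc n))
addLeaf G = record
  { edges    = (zero , suc zero) ∷ map lift (edges G)
  ; oriented = z<s ∷ All.map⁺ (All.map s<s (oriented G))
  ; nodup    = All.map⁺ (All.universal (λ _ ()) (edges G)) ∷ Unique.map⁺ lift-injective (nodup G)
  }
  where
  lift-injective : ∀ {e e′ : Fin _ × Fin _} → lift e ≡ lift e′ → e ≡ e′
  lift-injective {_ , _} {_ , _} refl = refl

module _ (G : Graph (suc n)) where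
  open ≡-Reasoning

  deg-addLeaf-zero : deg (addLeaf G) zero ≡ 1
  deg-addLeaf-zero = trans (deg≡degreeIn (addLeaf G) zero) (cong suc (degreeIn-lift-zero (edges G)))

  deg-addLeaf-one : deg (addLeaf G) (suc zero) ≡ suc (deg G zero)
  deg-addLeaf-one = begin
    deg (addLeaf G) (suc zero)                     ≡⟨ deg≡degreeIn (addLeaf G) (suc zero) ⟩
    suc (degreeIn (map lift (edges G)) (suc zero)) ≡⟨ cong suc (degreeIn-lift-suc (edges G) zero) ⟩
    suc (degreeIn (edges G) zero)                  ≡⟨ cong suc (deg≡degreeIn G zero) ⟨
    suc (deg G zero)                               ∎

  deg-addLeaf-suc-suc : ∀ u → deg (addLeaf G) (suc (suc u)) ≡ deg G (suc u)
  deg-addLeaf-suc-suc u = begin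
    deg (addLeaf G) (suc (suc u))               ≡⟨ deg≡degreeIn (addLeaf G) (suc (suc u)) ⟩
    degreeIn (map lift (edges G)) (suc (suc u)) ≡⟨ degreeIn-lift-suc (edges G) (suc u) ⟩
    degreeIn (edges G) (suc u)                  ≡⟨ deg≡degreeIn G (suc u) ⟨
    deg G (suc u)                               ∎

  upperEnds-addLeaf : upperEnds (addLeaf G) ≡ suc zero ∷ map suc (upperEnds G)
  upperEnds-addLeaf = cong (suc zero ∷_) (trans (sym (map-∘ (edges G))) (map-∘ (edges G)))

endDegrees : Graph n → Fin n × Fin n → ℕ × ℕ
endDegrees G = Product.map (deg G) (deg G)

degreePairs : Graph n → List (ℕ × ℕ)
degreePairs G = map (endDegrees G) (edges G)

endDegrees-addLeaf-lift : ∀ (G : Graph (suc n)) es →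
  map (endDegrees (addLeaf G)) (map lift (map lift es)) ≡ map (endDegrees G) (map lift es)
endDegrees-addLeaf-lift G []             = refl
endDegrees-addLeaf-lift G ((a , b) ∷ es) =
  cong₂ _∷_ (cong₂ _,_ (deg-addLeaf-suc-suc G a) (deg-addLeaf-suc-suc G b)) (endDegrees-addLeaf-lift G es)

degreePairs-addLeaf² : ∀ (G : Graph (suc n)) {d ps} → degreePairs (addLeaf G) ≡ (1 , d) ∷ ps →
                       degreePairs (addLeaf (addLeaf G)) ≡ (1 , 2) ∷ (2 , d) ∷ ps
degreePairs-addLeaf² G eq =
  cong₂ _∷_ (cong₂ _,_ (deg-addLeaf-zero H) deg₁)
    (cong₂ _∷_ (cong₂ _,_ deg₁ (trans (deg-addLeaf-suc-suc H zero) (cong proj₂ leaf-edge)))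
      (trans (endDegrees-addLeaf-lift H (edges G)) (∷-injectiveʳ eq)))
  where
  H = addLeaf G
  leaf-edge : endDegrees H (zero , suc zero) ≡ (1 , _)
  leaf-edge = ∷-injectiveˡ eq
  deg₁ : deg (addLeaf H) (suc zero) ≡ 2
  deg₁ = trans (deg-addLeaf-one H) (cong (suc ∘ proj₁) leaf-edge)

centredPath : Graph 5
centredPath = record
  { edges    = (# 0 , # 1) ∷ (# 1 , # 2) ∷ (# 0 , # 3) ∷ (# 3 , # 4) ∷ []
  ; oriented = z<s ∷ s<s z<s ∷ z<s ∷ s<s (s<s (s<s z<s)) ∷ []
  ; nodup    = Unique.map⁻ {f = proj₂} (Unique.map⁺ suc-injective (Unique.allFin⁺ 4))
  }

-- Legs of lengths k + 1, 2 and 2; vertex 0 is the end of the long leg.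
spider : (k : ℕ) → Graph (3 + k + 3)
spider zero    = addLeaf centredPath
spider (suc k) = addLeaf (spider k)

spider-upperEnds : ∀ k → upperEnds (spider k) ≡ map suc (allFin (2 + k + 3))
spider-upperEnds zero    = refl
spider-upperEnds (suc k) = trans (upperEnds-addLeaf (spider k))
  (cong (λ vs → suc zero ∷ map suc vs) (trans (spider-upperEnds k) (map-tabulate id suc)))

centrePairs : List (ℕ × ℕ)
centrePairs = (2 , 3) ∷ (3 , 2) ∷ (2 , 1) ∷ (3 , 2) ∷ (2 , 1) ∷ []

spider-degreePairs : ∀ k → degreePairs (spider (suc k)) ≡ (1 , 2) ∷ replicate k (2 , 2) ++ centrePairs
spider-degreePairs zero    = refl
spider-degreePairs (suc k) = degreePairs-addLeaf² (spider k) (spider-degreePairs k)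

fromℕ : ℕ → ℚ
fromℕ a = + a / 1

fromℕ≡mkℚ : ∀ a → fromℕ a ≡ mkℚ (+ a) 0 (Coprime.sym (1-coprimeTo a))
fromℕ≡mkℚ a = normalize-coprime (Coprime.sym (1-coprimeTo a))

fromℕ-+ : ∀ a b → fromℕ (a + b) ≡ fromℕ a ℚ.+ fromℕ b
fromℕ-+ a b = begin
  fromℕ (a + b)                     ≡⟨ cong (_/ 1) (ℤ.pos-+ a b) ⟩
  (+ a ℤ.+ + b) / 1                 ≡⟨ cong₂ (λ i j → (i ℤ.+ j) / 1) (ℤ.*-identityʳ (+ a)) (ℤ.*-identityʳ (+ b)) ⟨
  (+ a ℤ.* + 1 ℤ.+ + b ℤ.* + 1) / 1 ≡⟨ cong₂ ℚ._+_ (fromℕ≡mkℚ a) (fromℕ≡mkℚ b) ⟨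
  fromℕ a ℚ.+ fromℕ b               ∎
  where open ≡-Reasoning

fromℕ-inverse : ∀ m → fromℕ (suc m) ℚ.* (+ 1 / suc m) ≡ 1ℚ
fromℕ-inverse m = trans (cong₂ ℚ._*_ (fromℕ≡mkℚ (suc m)) (normalize-coprime (1-coprimeTo (suc m))))
                        (ℚ.*-inverseʳ (mkℚ (+ suc m) 0 (Coprime.sym (1-coprimeTo (suc m)))))

atPair : (ℚ → ℚ → ℚ) → ℕ × ℕ → ℚ
atPair ψ (a , b) = ψ (fromℕ a) (fromℕ b)

pairSum : (ℚ → ℚ → ℚ) → List (ℕ × ℕ) → ℚ
pairSum ψ = foldr (λ p s → atPair ψ p ℚ.+ s) 0ℚ

pairMean : (ℚ → ℚ → ℚ) → List (ℕ × ℕ) → ℚ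
pairMean ψ []           = 0ℚ
pairMean ψ ps@(_ ∷ ps′) = pairSum ψ ps ℚ.* (+ 1 / suc (length ps′))

edgeMean≡pairMean : ∀ (G : Graph n) ψ → edgeMean G (λ u v → ψ (dq G u) (dq G v)) ≡ pairMean ψ (degreePairs G)
edgeMean≡pairMean record { edges = [] }       ψ = refl
edgeMean≡pairMean G@record { edges = e ∷ es } ψ =
  cong₂ ℚ._*_ (sym (foldr-map (λ p s → atPair ψ p ℚ.+ s) (endDegrees G) 0ℚ (e ∷ es)))
              (cong (λ m → + 1 / suc m) (sym (length-map (endDegrees G) es)))

pairSum-++ : ∀ ψ ps qs → pairSum ψ (ps ++ qs) ≡ pairSum ψ ps ℚ.+ pairSum ψ qs
pairSum-++ ψ []       qs = sym (ℚ.+-identityˡ (pairSum ψ qs))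
pairSum-++ ψ (p ∷ ps) qs = trans (cong (atPair ψ p ℚ.+_) (pairSum-++ ψ ps qs))
                                 (sym (ℚ.+-assoc (atPair ψ p) (pairSum ψ ps) (pairSum ψ qs)))

pairSum-replicate : ∀ ψ k p → pairSum ψ (replicate k p) ≡ fromℕ k ℚ.* atPair ψ p
pairSum-replicate ψ zero    p = sym (ℚ.*-zeroˡ (atPair ψ p))
pairSum-replicate ψ (suc k) p = begin
  c ℚ.+ pairSum ψ (replicate k p)    ≡⟨ cong₂ ℚ._+_ (sym (ℚ.*-identityˡ c)) (pairSum-replicate ψ k p) ⟩
  1ℚ ℚ.* c ℚ.+ fromℕ k ℚ.* c         ≡⟨ ℚ.*-distribʳ-+ c 1ℚ (fromℕ k) ⟨
  (1ℚ ℚ.+ fromℕ k) ℚ.* c             ≡⟨ cong (ℚ._* c) (fromℕ-+ 1 k) ⟨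
  fromℕ (suc k) ℚ.* c                ∎
  where
  open ≡-Reasoning
  c = atPair ψ p

excess : (ℚ → ℚ → ℚ) → ℚ
excess ψ = atPair ψ (1 , 2) ℚ.+ pairSum ψ centrePairs ℚ.- fromℕ 6 ℚ.* atPair ψ (2 , 2)

spider-pairMean : ∀ k ψ → pairMean ψ ((1 , 2) ∷ replicate k (2 , 2) ++ centrePairs) ≡
                          atPair ψ (2 , 2) ℚ.+ excess ψ ℚ.* (+ 1 / suc (k + 5))
spider-pairMean k ψ = begin
  pairMean ψ ((1 , 2) ∷ replicate k (2 , 2) ++ centrePairs) ≡⟨ cong₂ (λ s m → (a ℚ.+ s) ℚ.* (+ 1 / suc m)) sum length-rest ⟩
  (a ℚ.+ (K ℚ.* c ℚ.+ L)) ℚ.* y                             ≡⟨ regroup a K c L S y ⟩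
  c ℚ.* ((K ℚ.+ S) ℚ.* y) ℚ.+ excess ψ ℚ.* y                ≡⟨ cong (λ t → c ℚ.* t ℚ.+ excess ψ ℚ.* y) inverse ⟩
  c ℚ.* 1ℚ ℚ.+ excess ψ ℚ.* y                               ≡⟨ cong (ℚ._+ excess ψ ℚ.* y) (ℚ.*-identityʳ c) ⟩
  c ℚ.+ excess ψ ℚ.* y                                      ∎
  where
  open ≡-Reasoning
  a = atPair ψ (1 , 2)
  c = atPair ψ (2 , 2)
  L = pairSum ψ centrePairs
  K = fromℕ k
  S = fromℕ 6
  y = + 1 / suc (k + 5)
  sum : pairSum ψ (replicate k (2 , 2) ++ centrePairs) ≡ K ℚ.* c ℚ.+ L
  sum = trans (pairSum-++ ψ (replicate k (2 , 2)) centrePairs) (cong (ℚ._+ L) (pairSum-replicate ψ k (2 , 2)))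
  length-rest : length (replicate k (2 , 2) ++ centrePairs) ≡ k + 5
  length-rest = trans (length-++ (replicate k (2 , 2))) (cong (_+ 5) (length-replicate k))
  inverse : (K ℚ.+ S) ℚ.* y ≡ 1ℚ
  inverse = trans (cong (ℚ._* y) (trans (sym (fromℕ-+ k 6)) (cong fromℕ (+-suc k 5)))) (fromℕ-inverse (k + 5))
  regroup : ∀ a K c L S y → (a ℚ.+ (K ℚ.* c ℚ.+ L)) ℚ.* y ≡ c ℚ.* ((K ℚ.+ S) ℚ.* y) ℚ.+ (a ℚ.+ L ℚ.- S ℚ.* c) ℚ.* y
  regroup = solve 6 (λ a K c L S y → (a :+ (K :* c :+ L)) :* y := c :* ((K :+ S) :* y) :+ (a :+ L :- S :* c) :* y) refl

module _ (k : ℕ) where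
  open ≡-Reasoning
  private
    T = spider (suc k)
    y = + 1 / suc (k + 5)

  spider-edgeMean : ∀ ψ → edgeMean T (λ u v → ψ (dq T u) (dq T v)) ≡ atPair ψ (2 , 2) ℚ.+ excess ψ ℚ.* y
  spider-edgeMean ψ = begin
    edgeMean T (λ u v → ψ (dq T u) (dq T v))                  ≡⟨ edgeMean≡pairMean T ψ ⟩
    pairMean ψ (degreePairs T)                                ≡⟨ cong (pairMean ψ) (spider-degreePairs k) ⟩
    pairMean ψ ((1 , 2) ∷ replicate k (2 , 2) ++ centrePairs) ≡⟨ spider-pairMean k ψ ⟩
    atPair ψ (2 , 2) ℚ.+ excess ψ ℚ.* y                       ∎

  spider-meanDeg : meanDeg T ≡ fromℕ 2
  spider-meanDeg = begin
    meanDeg T            ≡⟨ spider-edgeMean (λ p q → ½ ℚ.* (p ℚ.+ q)) ⟩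
    fromℕ 2 ℚ.+ 0ℚ ℚ.* y ≡⟨ cong (fromℕ 2 ℚ.+_) (ℚ.*-zeroˡ y) ⟩
    fromℕ 2 ℚ.+ 0ℚ       ≡⟨ ℚ.+-identityʳ (fromℕ 2) ⟩
    fromℕ 2              ∎

  spider-assortNum : assortNum T ≡ 0ℚ
  spider-assortNum = begin
    assortNum T                                  ≡⟨ cong₂ ℚ._-_ (spider-edgeMean ℚ._*_) (cong₂ ℚ._*_ spider-meanDeg spider-meanDeg) ⟩
    fromℕ 4 ℚ.+ 0ℚ ℚ.* y ℚ.- fromℕ 2 ℚ.* fromℕ 2 ≡⟨ cong (λ t → fromℕ 4 ℚ.+ t ℚ.- fromℕ 2 ℚ.* fromℕ 2) (ℚ.*-zeroˡ y) ⟩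
    fromℕ 4 ℚ.+ 0ℚ ℚ.- fromℕ 2 ℚ.* fromℕ 2       ≡⟨⟩
    0ℚ                                           ∎

  spider-assortDen : assortDen T ≡ fromℕ 3 ℚ.* y
  spider-assortDen = begin
    assortDen T                           ≡⟨ cong₂ ℚ._-_ (spider-edgeMean (λ p q → ½ ℚ.* (p ℚ.* p ℚ.+ q ℚ.* q)))
                                                         (cong₂ ℚ._*_ spider-meanDeg spider-meanDeg) ⟩
    fromℕ 4 ℚ.+ fromℕ 3 ℚ.* y ℚ.- fromℕ 4 ≡⟨ solve 2 (λ a b → a :+ b :- a := b) refl (fromℕ 4) (fromℕ 3 ℚ.* y) ⟩
    fromℕ 3 ℚ.* y                         ∎

  spider-neutral : Neutral T
  spider-neutral = den≢0 , spider-assortNum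
    where
    den-positive : ℚ.Positive (fromℕ 3 ℚ.* y)
    den-positive = ℚ.pos*pos⇒pos (fromℕ 3) y {{normalize-pos 1 (suc (k + 5))}}
    den≢0 : assortDen T ≢ 0ℚ
    den≢0 eq = ℚ.<-irrefl (trans (sym eq) spider-assortDen) (ℚ.positive⁻¹ _ {{den-positive}})

theorem2 : (n : ℕ) → 4 ≤ n → Σ (Graph (n + 3)) (λ T → IsTree T × Neutral T)
theorem2 (suc (suc (suc (suc k)))) (s≤s (s≤s (s≤s (s≤s z≤n)))) =
  spider (suc k) , upperEnds≡⇒IsTree (spider (suc k)) (spider-upperEnds (suc k)) , spider-neutral k
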